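{- (i) $\mathrm{true}$-conditional bisimilarity implies $\mathrm{id}$-congruence: ${\simeq_T}\subseteq{\sim_{\mathrm{id}}}$. (ii) The converse fails in general: there exist a category $\mathbf C$ with distinguished object $0$, a representative class of squares $\kappa$, a conditional reactive system $\mathcal S$ and arrows $a,b\colon0\to J$ with $(a,b)\in{\sim_{\mathrm{id}}}$ but $(a,b)\notin{\simeq_T}$.
   Context: Composition of $f\colon A\to B$, $g\colon B\to C$ is written $f;g$. Fix a category $\mathbf C$ with distinguished object $0$ and a representative class $\kappa$ of commuting squares: for every commuting square $\alpha_1;\delta_1=\alpha_2;\delta_2$ there are $(\alpha_1,\alpha_2,\beta_1,\beta_2)\in\kappa$ (a commuting square) and $\gamma$ with $\delta_1=\beta_1;\gamma$, $\delta_2=\beta_2;\gamma$; $\kappa(\alpha_1,\alpha_2)$ is the set of $(\beta_1,\beta_2)$ with $(\alpha_1,\alpha_2,\beta_1,\beta_2)\in\kappa$. Conditions over $A$ are defined inductively as $(A,\mathcal Q,S)$, $\mathcal Q\in\{\forall,\exists\}$, $S$ a finite set of pairs $(h,\mathcal A')$ with $h\colon A\to A'$, $\mathcal A'$ a condition over $A'$; $\mathrm{true}_A=(A,\forall,\emptyset)$. For $a\colon A\to B$: $a\models(A,\forall,S)$ iff for all $(h,\mathcal A')\in S$ and all $g$ with $a=h;g$, $g\models\mathcal A'$; $a\models(A,\exists,S)$ iff some $(h,\mathcal A')\in S$ and $g$ satisfy $a=h;g$, $g\models\mathcal A'$. $\mathcal A\models\mathcal B$: every arrow satisfying $\mathcal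 A$ satisfies $\mathcal B$. Boolean connectives have the standard semantics. Shift along $c\colon A\to B$: $(A,\mathcal Q,S)_{\downarrow c}=(B,\mathcal Q,\{(\beta,\mathcal A'_{\downarrow\alpha})\mid(h,\mathcal A')\in S,(\alpha,\beta)\in\kappa(h,c)\})$; it satisfies $c;d\models\mathcal A\iff d\models\mathcal A_{\downarrow c}$. A conditional reactive system is a set $\mathcal S$ of rules $(\ell,r,\mathcal R)$, $\ell,r\colon0\to I$, $\mathcal R$ a condition over $I$. Reaction: $a\leadsto a'$ iff there are a rule and $c$ with $a=\ell;c$, $a'=r;c$, $c\models\mathcal R$. ${\sim_{\mathrm{id}}}$ is the set of pairs $(a,b)$, $a,b\colon0\to J$, such that for every arrow $d$ with domain $J$, $a;d$ and $b;d$ are bisimilar with respect to the unlabelled transition relation $\leadsto$. Context step $a\xrightarrow[C]{f,\ \mathcal A}a'$ ($a\colon0\to J$, $f\colon J\to K$, $a'\colon0\to K$, $\mathcal A$ over $K$): there are a rule $(\ell,r,\mathcal R)\in\mathcal S$ and $c\colon I\to K$ with $a;f=\ell;c$, $a'=r;c$, $\mathcal A\models\mathcal R_{\downarrow c}$. $\mathcal D\models\bigvee_{i\in I}\mathcal E_i$ (possibly infinite $I$): every arrow satisfying $\mathcal D$ satisfies some $\mathcal E_i$. A conditional relation is a set of triples $(a,b,\mathcal C)$, $a,b\colon0\to J$, $\mathcal C$ a condition over $J$. A conditional bisimulation is a conditional relation $R$ such that for each $(a,b,\mathcal C)\in R$ and each context step $a\xrightarrow[C]{f,\ \mathcal A}a'$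 there are a (possibly infinite) index set $I$, context steps $b\xrightarrow[C]{f,\ \mathcal B_i}b'_i$ and conditions $\mathcal C'_i$ with $(a',b'_i,\mathcal C'_i)\in R$ and $\mathcal A\land\mathcal C_{\downarrow f}\models\bigvee_{i\in I}(\mathcal C'_i\land\mathcal B_i)$, and symmetrically for context steps of $b$; $\simeq_C$ is the set of triples in some conditional bisimulation, and ${\simeq_T}=\{(a,b)\mid a,b\colon0\to J,\ (a,b,\mathrm{true}_J)\in{\simeq_C}\}$. -}

module Defs where

open import Data.Product using (Σ; Σ-syntax; _×_; _,_; proj₁; proj₂)
open import Data.List using (List; []; _∷_; _++_)
open import Data.List.Relation.Unary.All using (All)
open import Data.List.Relation.Unary.Any using (Any)
open import Data.Unit using (⊤)
open import Data.Empty using (⊥)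
open import Data.Sum using (_⊎_)
open import Relation.Binary.PropositionalEquality using (_≡_)

-- A (small) category; composition in diagrammatic order  f ⨾ g  (the paper's f;g).
record Category : Set₁ where
  infixr 9 _⨾_
  field
    Obj : Set
    Hom : Obj → Obj → Set
    id  : ∀ {A} → Hom A A
    _⨾_ : ∀ {A B C} → Hom A B → Hom B C → Hom A C
    identityˡ : ∀ {A B} (f : Hom A B) → id ⨾ f ≡ f
    identityʳ : ∀ {A B} (f : Hom A B) → f ⨾ id ≡ f
    assoc : ∀ {A B C D} (f : Hom A B) (g : Hom B C) (h : Hom C D) →
            (f ⨾ g) ⨾ h ≡ f ⨾ (g ⨾ h)

data Quant : Set where
  ∀Q ∃Q : Quant

module _ (𝐂 : Category) where
  open Category 𝐂

  -- Conditions over A: (A, Q, S) with S a finite set (list) of pairs (h, 𝒜').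
  data Cond (A : Obj) : Set where
    cond : Quant → List (Σ[ A' ∈ Obj ] (Hom A A' × Cond A')) → Cond A

  true : ∀ {A} → Cond A
  true = cond ∀Q []

  mutual
    _⊨_ : ∀ {A B} → Hom A B → Cond A → Set
    a ⊨ cond ∀Q S = ⊨All a S
    a ⊨ cond ∃Q S = ⊨Any a S

    ⊨All : ∀ {A B} → Hom A B → List (Σ[ A' ∈ Obj ] (Hom A A' × Cond A')) → Set
    ⊨All a [] = ⊤
    ⊨All {B = B} a ((A' , h , 𝒜) ∷ S) =
      (∀ (g : Hom A' B) → a ≡ h ⨾ g → g ⊨ 𝒜) × ⊨All a S

    ⊨Any : ∀ {A B} → Hom A B → List (Σ[ A' ∈ Obj ] (Hom A A' × Cond A')) → Set
    ⊨Any a [] = ⊥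
    ⊨Any {B = B} a ((A' , h , 𝒜) ∷ S) =
      (Σ[ g ∈ Hom A' B ] (a ≡ h ⨾ g × g ⊨ 𝒜)) ⊎ ⊨Any a S

  _⊨ᶜ_ : ∀ {A} → Cond A → Cond A → Set
  _⊨ᶜ_ {A} 𝒜 ℬ = ∀ {B} (d : Hom A B) → d ⊨ 𝒜 → d ⊨ ℬ

  record RepSquares : Set where
    field
      κ : ∀ {A B C} → Hom A B → Hom A C → List (Σ[ D ∈ Obj ] (Hom B D × Hom C D))
      commutes : ∀ {A B C} (α₁ : Hom A B) (α₂ : Hom A C) →
        All (λ s → α₁ ⨾ proj₁ (proj₂ s) ≡ α₂ ⨾ proj₂ (proj₂ s)) (κ α₁ α₂)
      represents : ∀ {A B C E} (α₁ : Hom A B) (α₂ : Hom A C)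
        (δ₁ : Hom B E) (δ₂ : Hom C E) → α₁ ⨾ δ₁ ≡ α₂ ⨾ δ₂ →
        Any (λ s → Σ[ γ ∈ Hom (proj₁ s) E ]
                     (δ₁ ≡ proj₁ (proj₂ s) ⨾ γ × δ₂ ≡ proj₂ (proj₂ s) ⨾ γ))
            (κ α₁ α₂)

  module _ (K : RepSquares) where
    open RepSquares K

    mutual
      shift : ∀ {A B} → Cond A → Hom A B → Cond B
      shift (cond Q S) c = cond Q (shiftL S c)

      shiftL : ∀ {A B} → List (Σ[ A' ∈ Obj ] (Hom A A' × Cond A')) → Hom A B →
               List (Σ[ D ∈ Obj ] (Hom B D × Cond D))
      shiftL [] c = []
      shiftL ((A' , h , 𝒜) ∷ S) c = shiftSq 𝒜 (κ h c) ++ shiftL S c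

      shiftSq : ∀ {A' B} → Cond A' → List (Σ[ D ∈ Obj ] (Hom A' D × Hom B D)) →
                List (Σ[ D ∈ Obj ] (Hom B D × Cond D))
      shiftSq 𝒜 [] = []
      shiftSq 𝒜 ((D , α , β) ∷ L) = (D , β , shift 𝒜 α) ∷ shiftSq 𝒜 L

  record Rule (O : Obj) : Set where
    constructor rule
    field
      I : Obj
      ℓ r : Hom O I
      ℛ : Cond I

  module _ (O : Obj) (𝒮 : Rule O → Set) where

    _⇝_ : ∀ {J} → Hom O J → Hom O J → Set
    _⇝_ {J} a a' = Σ[ ρ ∈ Rule O ] (𝒮 ρ × Σ[ c ∈ Hom (Rule.I ρ) J ]
                     (a ≡ Rule.ℓ ρ ⨾ c × a' ≡ Rule.r ρ ⨾ c × c ⊨ Rule.ℛ ρ))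

    HRel : Set₁
    HRel = ∀ {J} → Hom O J → Hom O J → Set

    IsBisimulation : HRel → Set
    IsBisimulation R = ∀ {J} (a b : Hom O J) → R a b →
      (∀ a' → a ⇝ a' → Σ[ b' ∈ Hom O J ] (b ⇝ b' × R a' b')) ×
      (∀ b' → b ⇝ b' → Σ[ a' ∈ Hom O J ] (a ⇝ a' × R a' b'))

    Bisimilar : ∀ {J} → Hom O J → Hom O J → Set₁
    Bisimilar a b = Σ[ R ∈ HRel ] (IsBisimulation R × R a b)

    ∼id : ∀ {J} → Hom O J → Hom O J → Set₁
    ∼id {J} a b = ∀ {K} (d : Hom J K) → Bisimilar (a ⨾ d) (b ⨾ d)

    module _ (K : RepSquares) where

      CStep : ∀ {J L} → Hom O J → Hom J L → Cond L → Hom O L → Set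
      CStep {J} {L} a f 𝒜 a' = Σ[ ρ ∈ Rule O ] (𝒮 ρ × Σ[ c ∈ Hom (Rule.I ρ) L ]
        (a ⨾ f ≡ Rule.ℓ ρ ⨾ c × a' ≡ Rule.r ρ ⨾ c × 𝒜 ⊨ᶜ shift K (Rule.ℛ ρ) c))

      CRel : Set₁
      CRel = ∀ {J} → Hom O J → Hom O J → Cond J → Set

      IsCondBisim : CRel → Set₁
      IsCondBisim R = ∀ {J} (a b : Hom O J) (𝒞 : Cond J) → R a b 𝒞 →
        (∀ {L} (f : Hom J L) (𝒜 : Cond L) (a' : Hom O L) → CStep a f 𝒜 a' →
          Σ[ I ∈ Set ] Σ[ b' ∈ (I → Hom O L) ] Σ[ ℬ ∈ (I → Cond L) ] Σ[ 𝒞' ∈ (I → Cond L) ]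
            ((∀ i → CStep b f (ℬ i) (b' i)) ×
             (∀ i → R a' (b' i) (𝒞' i)) ×
             (∀ {M} (d : Hom L M) → d ⊨ 𝒜 → d ⊨ shift K 𝒞 f →
                Σ[ i ∈ I ] (d ⊨ 𝒞' i × d ⊨ ℬ i)))) ×
        (∀ {L} (f : Hom J L) (ℬ : Cond L) (b' : Hom O L) → CStep b f ℬ b' →
          Σ[ I ∈ Set ] Σ[ a' ∈ (I → Hom O L) ] Σ[ 𝒜 ∈ (I → Cond L) ] Σ[ 𝒞' ∈ (I → Cond L) ]
            ((∀ i → CStep a f (𝒜 i) (a' i)) ×
             (∀ i → R (a' i) b' (𝒞' i)) ×
             (∀ {M} (d : Hom L M) → d ⊨ ℬ → d ⊨ shift K 𝒞 f →
                Σ[ i ∈ I ] (d ⊨ 𝒞' i × d ⊨ 𝒜 i))))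

      ≃C : ∀ {J} → Hom O J → Hom O J → Cond J → Set₁
      ≃C a b 𝒞 = Σ[ R ∈ CRel ] (IsCondBisim R × R a b 𝒞)

      ≃T : ∀ {J} → Hom O J → Hom O J → Set₁
      ≃T a b = ≃C a b true

module Submission where

-- (i) The single semantic fact needed about shifts is  c ⨾ d ⊨ 𝒜 ⇔ d ⊨ 𝒜↓c
-- (module ShiftLemma), proved by mutual induction on conditions using that κ
-- consists of commuting squares (one direction) and is representative (other).
-- With it, reactions of a ⨾ f are exactly context steps of a along f whose
-- condition holds at id (module Steps).  Given a conditional bisimulation R,
-- its context closure {(a ⨾ e, b ⨾ e) | (a, b, 𝒞) ∈ R, e ⊨ 𝒞} is an ordinary
-- bisimulation: a reaction is turned into a context step, the transfer property
-- of R produces matching steps, and the cover is evaluated at id.  A triple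
-- (a, b, true) ∈ R then puts every (a ⨾ d, b ⨾ d) into the closure.
--
-- (ii) An explicit counterexample (module Counterexample): a category of
-- labelled inequalities of natural numbers in which X ∼id Y, but where Y can
-- only react under a non-trivial condition, so X ≄T Y.

open import Defs
open import Data.Product using (Σ-syntax; _×_; _,_; proj₁; proj₂)
open import Data.Sum using (_⊎_; inj₁; inj₂)
open import Data.Unit using (tt)
open import Data.Empty using (⊥-elim)
open import Data.List using (List; []; _∷_; _++_; map; filter; cartesianProduct)
open import Data.List.Relation.Unary.All using (All; []; _∷_)
open import Data.List.Relation.Unary.Any using (Any; here; there)
import Data.List.Relation.Unary.All as All
import Data.List.Relation.Unary.All.Properties as All
import Data.List.Relation.Unary.Any.Properties as Any
open import Data.List.Membership.Propositional using (_∈_; lose)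
open import Data.List.Membership.Propositional.Properties
  using (∈-filter⁺; ∈-cartesianProduct⁺)
open import Data.Maybe using (Maybe; just; nothing)
open import Data.Maybe.Properties using (≡-dec)
open import Data.Nat using (ℕ; _≤_; _⊔_; z≤n; s≤s)
open import Data.Nat.Properties
  using (≤-irrelevant; ≤-refl; ≤-trans; m≤m⊔n; m≤n⊔m; ⊔-lub; _≤?_)
open import Relation.Nullary using (¬_; yes; no)
open import Relation.Unary using (Decidable)
open import Relation.Binary.Definitions using (DecidableEquality)
open import Relation.Binary.PropositionalEquality
  using (_≡_; _≢_; refl; sym; cong; subst; subst₂; module ≡-Reasoning)

module ShiftLemma (𝐂 : Category) (K : RepSquares 𝐂) where
  open Category 𝐂
  open RepSquares K

  infix 4 _⊧_
  infixl 6 _↓_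

  _⊧_ : ∀ {A B} → Hom A B → Cond 𝐂 A → Set
  _⊧_ = _⊨_ 𝐂

  _↓_ : ∀ {A B} → Cond 𝐂 A → Hom A B → Cond 𝐂 B
  _↓_ = shift 𝐂 K

  Branches : Obj → Set
  Branches A = List (Σ[ A' ∈ Obj ] (Hom A A' × Cond 𝐂 A'))

  Squares : Obj → Obj → Set
  Squares A' B = List (Σ[ D ∈ Obj ] (Hom A' D × Hom B D))

  ⊨All-++⁺ : ∀ {A B} {d : Hom A B} (S T : Branches A) →
    ⊨All 𝐂 d S → ⊨All 𝐂 d T → ⊨All 𝐂 d (S ++ T)
  ⊨All-++⁺ []      T _        q = q
  ⊨All-++⁺ (_ ∷ S) T (p , ps) q = p , ⊨All-++⁺ S T ps q

  ⊨All-++⁻ : ∀ {A B} {d : Hom A B} (S T : Branches A) →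
    ⊨All 𝐂 d (S ++ T) → ⊨All 𝐂 d S × ⊨All 𝐂 d T
  ⊨All-++⁻ []      T q        = tt , q
  ⊨All-++⁻ (_ ∷ S) T (p , ps) with ⊨All-++⁻ S T ps
  ... | qs , qt = (p , qs) , qt

  ⊨Any-++⁺ˡ : ∀ {A B} {d : Hom A B} (S T : Branches A) → ⊨Any 𝐂 d S → ⊨Any 𝐂 d (S ++ T)
  ⊨Any-++⁺ˡ (_ ∷ S) T (inj₁ p) = inj₁ p
  ⊨Any-++⁺ˡ (_ ∷ S) T (inj₂ p) = inj₂ (⊨Any-++⁺ˡ S T p)

  ⊨Any-++⁺ʳ : ∀ {A B} {d : Hom A B} (S T : Branches A) → ⊨Any 𝐂 d T → ⊨Any 𝐂 d (S ++ T)
  ⊨Any-++⁺ʳ []      T p = p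
  ⊨Any-++⁺ʳ (_ ∷ S) T p = inj₂ (⊨Any-++⁺ʳ S T p)

  ⊨Any-++⁻ : ∀ {A B} {d : Hom A B} (S T : Branches A) →
    ⊨Any 𝐂 d (S ++ T) → ⊨Any 𝐂 d S ⊎ ⊨Any 𝐂 d T
  ⊨Any-++⁻ []      T p        = inj₂ p
  ⊨Any-++⁻ (_ ∷ S) T (inj₁ p) = inj₁ (inj₁ p)
  ⊨Any-++⁻ (_ ∷ S) T (inj₂ p) with ⊨Any-++⁻ S T p
  ... | inj₁ q = inj₁ (inj₂ q)
  ... | inj₂ q = inj₂ q

  paste : ∀ {A A' B D E} (h : Hom A A') (c : Hom A B) (α : Hom A' D) (β : Hom B D)
    {d : Hom B E} (g : Hom D E) → h ⨾ α ≡ c ⨾ β → d ≡ β ⨾ g → c ⨾ d ≡ h ⨾ (α ⨾ g)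
  paste h c α β {d} g square d≡βg = begin
    c ⨾ d        ≡⟨ cong (c ⨾_) d≡βg ⟩
    c ⨾ (β ⨾ g)  ≡⟨ sym (assoc c β g) ⟩
    (c ⨾ β) ⨾ g  ≡⟨ cong (_⨾ g) (sym square) ⟩
    (h ⨾ α) ⨾ g  ≡⟨ assoc h α g ⟩
    h ⨾ (α ⨾ g)  ∎
    where open ≡-Reasoning

  FactorsThrough : ∀ {A' B E} → Hom A' E → Hom B E → Σ[ D ∈ Obj ] (Hom A' D × Hom B D) → Set
  FactorsThrough {E = E} g d (D , α , β) = Σ[ γ ∈ Hom D E ] (g ≡ α ⨾ γ × d ≡ β ⨾ γ)

  Commutes : ∀ {A A' B} → Hom A A' → Hom A B → Σ[ D ∈ Obj ] (Hom A' D × Hom B D) → Set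
  Commutes h c (D , α , β) = h ⨾ α ≡ c ⨾ β

  -- A universal branch (h, 𝒜') of 𝒜
  -- becomes the branches (β, 𝒜'↓α) for (α, β) ∈ κ(h, c); they hold by pasting
  -- the square.  An existential witness g with c ⨾ d = h ⨾ g factors through
  -- some square of κ(h, c) because κ is representative.
  mutual
    shift-intro : ∀ {A B E} (𝒜 : Cond 𝐂 A) (c : Hom A B) (d : Hom B E) →
      c ⨾ d ⊧ 𝒜 → d ⊧ 𝒜 ↓ c
    shift-intro (cond ∀Q S) c d p = all-intro S c d p
    shift-intro (cond ∃Q S) c d p = any-intro S c d p

    all-intro : ∀ {A B E} (S : Branches A) (c : Hom A B) (d : Hom B E) →
      ⊨All 𝐂 (c ⨾ d) S → ⊨All 𝐂 d (shiftL 𝐂 K S c)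
    all-intro []                  c d _        = tt
    all-intro ((_ , h , 𝒜) ∷ S) c d (p , ps) =
      ⊨All-++⁺ (shiftSq 𝐂 K 𝒜 (κ h c)) (shiftL 𝐂 K S c)
        (squares-all-intro h c d 𝒜 (κ h c) (commutes h c) p) (all-intro S c d ps)

    squares-all-intro : ∀ {A A' B E} (h : Hom A A') (c : Hom A B) (d : Hom B E)
      (𝒜 : Cond 𝐂 A') (L : Squares A' B) → All (Commutes h c) L →
      (∀ g → c ⨾ d ≡ h ⨾ g → g ⊧ 𝒜) → ⊨All 𝐂 d (shiftSq 𝐂 K 𝒜 L)
    squares-all-intro h c d 𝒜 []                []            p = tt
    squares-all-intro h c d 𝒜 ((_ , α , β) ∷ L) (square ∷ sq) p =
      (λ g d≡βg → shift-intro 𝒜 α g (p (α ⨾ g) (paste h c α β g square d≡βg))) ,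
      squares-all-intro h c d 𝒜 L sq p

    any-intro : ∀ {A B E} (S : Branches A) (c : Hom A B) (d : Hom B E) →
      ⊨Any 𝐂 (c ⨾ d) S → ⊨Any 𝐂 d (shiftL 𝐂 K S c)
    any-intro ((_ , h , 𝒜) ∷ S) c d (inj₁ (g , cd≡hg , g⊨𝒜)) =
      ⊨Any-++⁺ˡ (shiftSq 𝐂 K 𝒜 (κ h c)) (shiftL 𝐂 K S c)
        (squares-any-intro d 𝒜 g g⊨𝒜 (κ h c) (represents h c g d (sym cd≡hg)))
    any-intro ((_ , h , 𝒜) ∷ S) c d (inj₂ p) =
      ⊨Any-++⁺ʳ (shiftSq 𝐂 K 𝒜 (κ h c)) (shiftL 𝐂 K S c) (any-intro S c d p)

    squares-any-intro : ∀ {A' B E} (d : Hom B E) (𝒜 : Cond 𝐂 A') (g : Hom A' E) →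
      g ⊧ 𝒜 → (L : Squares A' B) → Any (FactorsThrough g d) L →
      ⊨Any 𝐂 d (shiftSq 𝐂 K 𝒜 L)
    squares-any-intro d 𝒜 g g⊨𝒜 ((_ , α , β) ∷ L) (here (γ , g≡αγ , d≡βγ)) =
      inj₁ (γ , d≡βγ , shift-intro 𝒜 α γ (subst (_⊧ 𝒜) g≡αγ g⊨𝒜))
    squares-any-intro d 𝒜 g g⊨𝒜 (_ ∷ L) (there p) = inj₂ (squares-any-intro d 𝒜 g g⊨𝒜 L p)

  -- Elimination: d ⊨ 𝒜↓c implies c ⨾ d ⊨ 𝒜, dually (representativity is now
  -- used for the universal branches and commutativity for the existential ones).
  mutual
    shift-elim : ∀ {A B E} (𝒜 : Cond 𝐂 A) (c : Hom A B) (d : Hom B E) →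
      d ⊧ 𝒜 ↓ c → c ⨾ d ⊧ 𝒜
    shift-elim (cond ∀Q S) c d p = all-elim S c d p
    shift-elim (cond ∃Q S) c d p = any-elim S c d p

    all-elim : ∀ {A B E} (S : Branches A) (c : Hom A B) (d : Hom B E) →
      ⊨All 𝐂 d (shiftL 𝐂 K S c) → ⊨All 𝐂 (c ⨾ d) S
    all-elim []                  c d _ = tt
    all-elim ((_ , h , 𝒜) ∷ S) c d p
      with ⊨All-++⁻ (shiftSq 𝐂 K 𝒜 (κ h c)) (shiftL 𝐂 K S c) p
    ... | here-ok , rest-ok =
      (λ g cd≡hg → squares-all-elim d 𝒜 g (κ h c) here-ok (represents h c g d (sym cd≡hg))) ,
      all-elim S c d rest-ok

    squares-all-elim : ∀ {A' B E} (d : Hom B E) (𝒜 : Cond 𝐂 A') (g : Hom A' E)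
      (L : Squares A' B) → ⊨All 𝐂 d (shiftSq 𝐂 K 𝒜 L) → Any (FactorsThrough g d) L →
      g ⊧ 𝒜
    squares-all-elim d 𝒜 g ((_ , α , β) ∷ L) (p , _) (here (γ , g≡αγ , d≡βγ)) =
      subst (_⊧ 𝒜) (sym g≡αγ) (shift-elim 𝒜 α γ (p γ d≡βγ))
    squares-all-elim d 𝒜 g (_ ∷ L) (_ , ps) (there q) = squares-all-elim d 𝒜 g L ps q

    any-elim : ∀ {A B E} (S : Branches A) (c : Hom A B) (d : Hom B E) →
      ⊨Any 𝐂 d (shiftL 𝐂 K S c) → ⊨Any 𝐂 (c ⨾ d) S
    any-elim ((_ , h , 𝒜) ∷ S) c d p
      with ⊨Any-++⁻ (shiftSq 𝐂 K 𝒜 (κ h c)) (shiftL 𝐂 K S c) p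
    ... | inj₁ q = inj₁ (squares-any-elim h c d 𝒜 (κ h c) (commutes h c) q)
    ... | inj₂ q = inj₂ (any-elim S c d q)

    squares-any-elim : ∀ {A A' B E} (h : Hom A A') (c : Hom A B) (d : Hom B E)
      (𝒜 : Cond 𝐂 A') (L : Squares A' B) → All (Commutes h c) L →
      ⊨Any 𝐂 d (shiftSq 𝐂 K 𝒜 L) → Σ[ g ∈ Hom A' E ] (c ⨾ d ≡ h ⨾ g × g ⊧ 𝒜)
    squares-any-elim h c d 𝒜 ((_ , α , β) ∷ L) (square ∷ _) (inj₁ (g , d≡βg , g⊨)) =
      α ⨾ g , paste h c α β g square d≡βg , shift-elim 𝒜 α g g⊨
    squares-any-elim h c d 𝒜 (_ ∷ L) (_ ∷ sq) (inj₂ q) = squares-any-elim h c d 𝒜 L sq q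

  id-shift-intro : ∀ {A B} (𝒜 : Cond 𝐂 A) (c : Hom A B) → c ⊧ 𝒜 → id ⊧ 𝒜 ↓ c
  id-shift-intro 𝒜 c c⊨𝒜 = shift-intro 𝒜 c id (subst (_⊧ 𝒜) (sym (identityʳ c)) c⊨𝒜)

  id-shift-elim : ∀ {A B} (𝒜 : Cond 𝐂 A) (c : Hom A B) → id ⊧ 𝒜 ↓ c → c ⊧ 𝒜
  id-shift-elim 𝒜 c p = subst (_⊧ 𝒜) (identityʳ c) (shift-elim 𝒜 c id p)

module Steps (𝐂 : Category) (K : RepSquares 𝐂) (O : Category.Obj 𝐂) (𝒮 : Rule 𝐂 O → Set) where
  open Category 𝐂
  open ShiftLemma 𝐂 K

  infix 4 _↝_
  _↝_ : ∀ {J} → Hom O J → Hom O J → Set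
  _↝_ = _⇝_ 𝐂 O 𝒮

  Step : ∀ {J L} → Hom O J → Hom J L → Cond 𝐂 L → Hom O L → Set
  Step = CStep 𝐂 O 𝒮 K

  reaction⇒step : ∀ {J L} {a : Hom O J} {f : Hom J L} {a' : Hom O L} →
    a ⨾ f ↝ a' → Σ[ 𝒜 ∈ Cond 𝐂 L ] (Step a f 𝒜 a' × id ⊧ 𝒜)
  reaction⇒step (ρ , ρ∈𝒮 , c , af≡ℓc , a'≡rc , c⊨ℛ) =
    Rule.ℛ ρ ↓ c , (ρ , ρ∈𝒮 , c , af≡ℓc , a'≡rc , λ d d⊨ → d⊨) ,
    id-shift-intro (Rule.ℛ ρ) c c⊨ℛ

  step⇒reaction : ∀ {J L} {b : Hom O J} {f : Hom J L} {ℬ : Cond 𝐂 L} {b' : Hom O L} →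
    Step b f ℬ b' → id ⊧ ℬ → b ⨾ f ↝ b'
  step⇒reaction (ρ , ρ∈𝒮 , c , bf≡ℓc , b'≡rc , ℬ⊨ℛ↓c) id⊨ℬ =
    ρ , ρ∈𝒮 , c , bf≡ℓc , b'≡rc , id-shift-elim (Rule.ℛ ρ) c (ℬ⊨ℛ↓c id id⊨ℬ)

  Transfer : CRel 𝐂 O 𝒮 K → ∀ {J} → Hom O J → Hom O J → Cond 𝐂 J → Set₁
  Transfer P {J} a b 𝒞 = ∀ {L} (f : Hom J L) (𝒜 : Cond 𝐂 L) (a' : Hom O L) → Step a f 𝒜 a' →
    Σ[ I ∈ Set ] Σ[ b' ∈ (I → Hom O L) ] Σ[ ℬ ∈ (I → Cond 𝐂 L) ] Σ[ 𝒞' ∈ (I → Cond 𝐂 L) ]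
      ((∀ i → Step b f (ℬ i) (b' i)) ×
       (∀ i → P a' (b' i) (𝒞' i)) ×
       (∀ {M} (d : Hom L M) → d ⊧ 𝒜 → d ⊧ 𝒞 ↓ f → Σ[ i ∈ I ] (d ⊧ 𝒞' i × d ⊧ ℬ i)))

  -- If (a, b, 𝒞) has the transfer property and e ⊨ 𝒞, every reaction of a ⨾ e is
  -- matched by a reaction of b ⨾ e into a P-related triple whose condition id
  -- satisfies: view the reaction as a context step along e, apply the transfer,
  -- and evaluate the resulting cover at id.
  simulate : ∀ (P : CRel 𝐂 O 𝒮 K) {J L} {a b : Hom O J} {𝒞 : Cond 𝐂 J} {e : Hom J L} {x' : Hom O L} →
    Transfer P a b 𝒞 → e ⊧ 𝒞 → a ⨾ e ↝ x' →
    Σ[ y' ∈ Hom O L ] (b ⨾ e ↝ y' × Σ[ 𝒞' ∈ Cond 𝐂 L ] (P x' y' 𝒞' × id ⊧ 𝒞'))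
  simulate P {𝒞 = 𝒞} {e} {x'} transfer e⊨𝒞 reaction
    with reaction⇒step reaction
  ... | 𝒜 , step , id⊨𝒜
    with transfer e 𝒜 x' step
  ... | _ , b' , ℬ , 𝒞' , b-steps , related , cover
    with cover id id⊨𝒜 (id-shift-intro 𝒞 e e⊨𝒞)
  ... | i , id⊨𝒞' , id⊨ℬ =
    b' i , step⇒reaction {ℬ = ℬ i} (b-steps i) id⊨ℬ , 𝒞' i , related i , id⊨𝒞'

  data Closure (R : CRel 𝐂 O 𝒮 K) : HRel 𝐂 O 𝒮 where
    in-context : ∀ {J L} {a b : Hom O J} {𝒞 : Cond 𝐂 J} (e : Hom J L) →
      R a b 𝒞 → e ⊧ 𝒞 → Closure R (a ⨾ e) (b ⨾ e)

  closure-id : ∀ {R : CRel 𝐂 O 𝒮 K} {J} {a b : Hom O J} {𝒞 : Cond 𝐂 J} →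
    R a b 𝒞 → id ⊧ 𝒞 → Closure R a b
  closure-id {R} {a = a} {b} r id⊨𝒞 =
    subst₂ (Closure R) (identityʳ a) (identityʳ b) (in-context id r id⊨𝒞)

  closure-bisim : ∀ (R : CRel 𝐂 O 𝒮 K) → IsCondBisim 𝐂 O 𝒮 K R →
    IsBisimulation 𝐂 O 𝒮 (Closure R)
  closure-bisim R isBisim _ _ (in-context {a = a} {b} {𝒞} e r e⊨𝒞) =
    (λ _ a-reacts →
      let y' , b-reacts , _ , r' , id⊨𝒞' = simulate R {𝒞 = 𝒞} (proj₁ transfer) e⊨𝒞 a-reacts
      in y' , b-reacts , closure-id r' id⊨𝒞') ,
    (λ _ b-reacts →
      let x' , a-reacts , _ , r' , id⊨𝒞' =
            simulate (λ y x → R x y) {𝒞 = 𝒞} (proj₂ transfer) e⊨𝒞 b-reacts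
      in x' , a-reacts , closure-id r' id⊨𝒞')
    where
    transfer : Transfer R a b 𝒞 × Transfer (λ y x → R x y) b a 𝒞
    transfer = isBisim a b 𝒞 r

≃T⇒∼id : (𝐂 : Category) (O : Category.Obj 𝐂) (𝒮 : Rule 𝐂 O → Set) (K : RepSquares 𝐂)
  {J : Category.Obj 𝐂} (a b : Category.Hom 𝐂 O J) → ≃T 𝐂 O 𝒮 K a b → ∼id 𝐂 O 𝒮 a b
≃T⇒∼id 𝐂 O 𝒮 K a b (R , isBisim , r) d =
  Closure R , closure-bisim R isBisim , in-context d r tt
  where open Steps 𝐂 K O 𝒮

-- Objects are natural numbers; an arrow A → B is a proof of A ≤ B
-- together with a tag, and composition keeps the leftmost proper label.  States
-- 0 → 1 are labelled X or Y; both kinds react to Z (which is stuck) in every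
-- context, so X ∼id Y.  But Y reacts in context 1 only under the condition
-- "1 is not extended to 2", while the X-rule has condition true; hence no
-- true-conditional bisimulation relates X and Y.
module Counterexample where

  data Label : Set where
    X Y Z : Label

  _≟ˡ_ : DecidableEquality Label
  X ≟ˡ X = yes refl
  X ≟ˡ Y = no λ ()
  X ≟ˡ Z = no λ ()
  Y ≟ˡ X = no λ ()
  Y ≟ˡ Y = yes refl
  Y ≟ˡ Z = no λ ()
  Z ≟ˡ X = no λ ()
  Z ≟ˡ Y = no λ ()
  Z ≟ˡ Z = yes refl

  Tag : Set
  Tag = Maybe Label

  infix 4 _≟ᵗ_
  _≟ᵗ_ : DecidableEquality Tag
  _≟ᵗ_ = ≡-dec _≟ˡ_

  infixr 7 _∙_
  _∙_ : Tag → Tag → Tag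
  nothing ∙ n = n
  just u  ∙ _ = just u

  ∙-identityʳ : ∀ m → m ∙ nothing ≡ m
  ∙-identityʳ nothing  = refl
  ∙-identityʳ (just _) = refl

  ∙-assoc : ∀ m n k → (m ∙ n) ∙ k ≡ m ∙ (n ∙ k)
  ∙-assoc nothing  n k = refl
  ∙-assoc (just _) n k = refl

  tags : List Tag
  tags = nothing ∷ just X ∷ just Y ∷ just Z ∷ []

  ∈-tags : ∀ m → m ∈ tags
  ∈-tags nothing  = here refl
  ∈-tags (just X) = there (here refl)
  ∈-tags (just Y) = there (there (here refl))
  ∈-tags (just Z) = there (there (there (here refl)))

  Arr : ℕ → ℕ → Set
  Arr A B = A ≤ B × Tag

  -- Arrows are determined by their tags, since ≤-proofs are unique.
  arr-≡ : ∀ {A B} {p q : A ≤ B} {m n : Tag} → m ≡ n → (p , m) ≡ (q , n)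
  arr-≡ {p = p} {q} refl = cong (_, _) (≤-irrelevant p q)

  𝐂 : Category
  𝐂 = record
    { Obj = ℕ
    ; Hom = Arr
    ; id = ≤-refl , nothing
    ; _⨾_ = λ (p , m) (q , n) → ≤-trans p q , m ∙ n
    ; identityˡ = λ _ → arr-≡ refl
    ; identityʳ = λ (_ , m) → arr-≡ (∙-identityʳ m)
    ; assoc = λ (_ , m) (_ , n) (_ , k) → arr-≡ (∙-assoc m n k)
    }

  open Category 𝐂 using (_⨾_; id)

  -- Any commuting square factors
  -- through the one with the same tags, via the untagged arrow into its tip.
  completes? : (m₁ m₂ : Tag) → Decidable (λ ((n₁ , n₂) : Tag × Tag) → m₁ ∙ n₁ ≡ m₂ ∙ n₂)
  completes? m₁ m₂ (n₁ , n₂) = m₁ ∙ n₁ ≟ᵗ m₂ ∙ n₂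

  square : ∀ B C → Tag × Tag → Σ[ D ∈ ℕ ] (Arr B D × Arr C D)
  square B C (n₁ , n₂) = B ⊔ C , (m≤m⊔n B C , n₁) , (m≤n⊔m B C , n₂)

  squares : ∀ {A B C} → Arr A B → Arr A C → List (Σ[ D ∈ ℕ ] (Arr B D × Arr C D))
  squares {B = B} {C} (_ , m₁) (_ , m₂) =
    map (square B C) (filter (completes? m₁ m₂) (cartesianProduct tags tags))

  κ : RepSquares 𝐂
  κ = record
    { κ = squares
    ; commutes = λ (_ , m₁) (_ , m₂) →
        All.map⁺ (All.map arr-≡ (All.all-filter (completes? m₁ m₂) _))
    ; represents = λ (_ , m₁) (_ , m₂) (q₁ , n₁) (q₂ , n₂) commuting →
        Any.map⁺ (lose
          (∈-filter⁺ (completes? m₁ m₂)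
            (∈-cartesianProduct⁺ (∈-tags n₁) (∈-tags n₂)) (cong proj₂ commuting))
          ((⊔-lub q₁ q₂ , nothing) ,
           arr-≡ (sym (∙-identityʳ n₁)) , arr-≡ (sym (∙-identityʳ n₂))))
    }

  extend : Arr 1 2
  extend = s≤s z≤n , nothing

  not-extended : Cond 𝐂 1
  not-extended = cond ∀Q ((2 , extend , cond ∃Q []) ∷ [])

  labelled : ∀ {I} → Label → Arr 0 I
  labelled u = z≤n , just u

  ρX ρY ρY₂ : Rule 𝐂 0
  ρX  = rule 1 (labelled X) (labelled Z) (true 𝐂)
  ρY  = rule 1 (labelled Y) (labelled Z) not-extended
  ρY₂ = rule 2 (labelled Y) (labelled Z) (true 𝐂)

  data Rules : Rule 𝐂 0 → Set where
    x-rule  : Rules ρX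
    y-rule  : Rules ρY
    y-rule₂ : Rules ρY₂

  open Steps 𝐂 κ 0 Rules using (_↝_; Step)

  tag : ∀ {A B} → Arr A B → Tag
  tag = proj₂

  reactant-not-Z : ∀ {J} {x x' : Arr 0 J} → x ↝ x' → tag x ≢ just Z
  reactant-not-Z (_ , x-rule  , _ , refl , _) ()
  reactant-not-Z (_ , y-rule  , _ , refl , _) ()
  reactant-not-Z (_ , y-rule₂ , _ , refl , _) ()

  product-is-Z : ∀ {J} {x x' : Arr 0 J} → x ↝ x' → tag x' ≡ just Z
  product-is-Z (_ , x-rule  , _ , _ , refl , _) = refl
  product-is-Z (_ , y-rule  , _ , _ , refl , _) = refl
  product-is-Z (_ , y-rule₂ , _ , _ , refl , _) = refl

  X-reacts : ∀ {J} (x : Arr 0 J) → tag x ≡ just X → 1 ≤ J → Σ[ x' ∈ Arr 0 J ] (x ↝ x')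
  X-reacts (_ , _) refl 1≤J = _ , ρX , x-rule , (1≤J , nothing) , arr-≡ refl , refl , tt

  Y-reacts : ∀ {J} (y : Arr 0 J) → tag y ≡ just Y → 1 ≤ J → Σ[ y' ∈ Arr 0 J ] (y ↝ y')
  Y-reacts {J} (_ , _) refl 1≤J with 2 ≤? J
  ... | yes 2≤J = _ , ρY₂ , y-rule₂ , (2≤J , nothing) , arr-≡ refl , refl , tt
  ... | no  2≰J = _ , ρY , y-rule , (1≤J , nothing) , arr-≡ refl , refl ,
                  (λ (2≤J , _) _ → ⊥-elim (2≰J 2≤J)) , tt

  data XY-related : HRel 𝐂 0 Rules where
    before : ∀ {J} {x y : Arr 0 J} → tag x ≡ just X → tag y ≡ just Y → 1 ≤ J → XY-related x y
    after  : ∀ {J} {x y : Arr 0 J} → tag x ≡ just Z → tag y ≡ just Z → XY-related x y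

  XY-bisim : IsBisimulation 𝐂 0 Rules XY-related
  XY-bisim x y (before x-X y-Y 1≤J) =
    (λ _ x↝x' → let y' , y↝y' = Y-reacts y y-Y 1≤J
                in y' , y↝y' , after (product-is-Z x↝x') (product-is-Z y↝y')) ,
    (λ _ y↝y' → let x' , x↝x' = X-reacts x x-X 1≤J
                in x' , x↝x' , after (product-is-Z x↝x') (product-is-Z y↝y'))
  XY-bisim x y (after x-Z y-Z) =
    (λ _ x↝x' → ⊥-elim (reactant-not-Z x↝x' x-Z)) ,
    (λ _ y↝y' → ⊥-elim (reactant-not-Z y↝y' y-Z))

  a b : Arr 0 1
  a = labelled X
  b = labelled Y

  a∼b : ∼id 𝐂 0 Rules a b
  a∼b (1≤K , _) = XY-related , XY-bisim , before refl refl 1≤K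

  open ShiftLemma 𝐂 κ using (_⊧_; shift-elim)

  -- No context step of b along id has a condition satisfied by extend: such a
  -- step uses the Y-rule (the X-rule has the wrong label and the second Y-rule
  -- needs an arrow 2 → 1), whose condition extend violates.
  b-blocked : ∀ {ℬ b'} → Step b id ℬ b' → ¬ (extend ⊧ ℬ)
  b-blocked (_ , x-rule , _ , () , _)
  b-blocked (_ , y-rule , (p , m) , _ , _ , ℬ⊨ℛ↓c) extend⊨ℬ =
    proj₁ (shift-elim not-extended (p , m) extend (ℬ⊨ℛ↓c extend extend⊨ℬ))
      (≤-refl , m) (arr-≡ (∙-identityʳ m))
  b-blocked (_ , y-rule₂ , (s≤s () , _) , _)

  -- a reacts unconditionally in context id; b cannot match this step under
  -- condition true, since the cover would have to apply to the arrow extend.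
  a≄b : ¬ ≃T 𝐂 0 Rules κ a b
  a≄b (R , isBisim , r) =
    let a-step : Step a id (true 𝐂) (labelled Z ⨾ id)
        a-step = ρX , x-rule , id , refl , refl , λ _ d⊨ → d⊨
        _ , _ , ℬ , _ , b-steps , _ , cover = proj₁ (isBisim a b (true 𝐂) r) id (true 𝐂) _ a-step
        i , _ , extend⊨ℬᵢ = cover extend tt tt
    in b-blocked {ℬ i} (b-steps i) extend⊨ℬᵢ

theorem6p6 : ((𝐂 : Category) (O : Category.Obj 𝐂) (𝒮 : Rule 𝐂 O → Set) (K : RepSquares 𝐂)
    {J : Category.Obj 𝐂} (a b : Category.Hom 𝐂 O J) →
    ≃T 𝐂 O 𝒮 K a b → ∼id 𝐂 O 𝒮 a b)
    ×
    (Σ[ 𝐂 ∈ Category ] Σ[ O ∈ Category.Obj 𝐂 ] Σ[ 𝒮 ∈ (Rule 𝐂 O → Set) ]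
    Σ[ K ∈ RepSquares 𝐂 ] Σ[ J ∈ Category.Obj 𝐂 ]
    Σ[ a ∈ Category.Hom 𝐂 O J ] Σ[ b ∈ Category.Hom 𝐂 O J ]
    (∼id 𝐂 O 𝒮 a b × ¬ ≃T 𝐂 O 𝒮 K a b))
theorem6p6 = ≃T⇒∼id , (𝐂 , 0 , Rules , κ , 1 , a , b , a∼b , a≄b)
  where open Counterexample
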